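{- A lattice $L$ is distributive if and only if every point of the bitopological space $(\mathfrak{M}(L),\tau_L,\sigma_L)$ is prime, i.e. for every $p\in\mathfrak{M}(L)$ the $\tau_L$-closure of $\{p\}$ equals the $\sigma_L$-closure of $\{p\}$.
   Context: Ideals and filters are nonempty. A comaximal pair of $L$ is $(I,F)$, $I$ an ideal, $F$ a filter, $I\cap F=\emptyset$, such that every ideal $J\supsetneq I$ meets $F$ and every filter $K\supsetneq F$ meets $I$; $\mathfrak{M}(L)$ is the set of comaximal pairs. $\sigma_L$ is the topology on $\mathfrak{M}(L)$ with basis $\{\{(I,F): x\in F\}:x\in L\}$ and $\tau_L$ the topology generated by the subbasis $\{\{(I,F):x\notin I\}:x\in L\}$. -}

module Defs where

open import Level using (Level; _⊔_; suc; Setω)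
open import Data.Product using (Σ; ∃; ∃-syntax; _×_; _,_)
open import Data.Sum using (_⊎_)
open import Data.List using (List)
open import Data.List.Relation.Unary.All using (All)
open import Data.Empty using (⊥)
open import Relation.Nullary using (¬_)
open import Relation.Unary using (Pred; _⊆_)
open import Relation.Binary.PropositionalEquality using (_≡_)
open import Relation.Binary.Lattice using (Lattice; IsDistributiveLattice)
open import Axiom.ExcludedMiddle using (ExcludedMiddle)

module _ {a ℓ : Level} {X : Set a} where

  IsOpenFromBasis : ∀ {i} {ι : Set i} → (ι → Pred X ℓ) → Pred X ℓ → Set (a ⊔ ℓ ⊔ i)
  IsOpenFromBasis {ι} B U = ∀ q → U q → ∃[ i ] (B i q × B i ⊆ U)

  -- Opens of the topology on X generated by the subbasis S:
  -- unions of finite intersections of subbasic sets (empty intersection = X).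
  IsOpenFromSubbasis : ∀ {i} {ι : Set i} → (ι → Pred X ℓ) → Pred X ℓ → Set (a ⊔ ℓ ⊔ i)
  IsOpenFromSubbasis {ι} S U =
    ∀ q → U q → ∃[ is ] (All (λ i → S i q) is × (∀ r → All (λ i → S i r) is → U r))

  closure : ∀ {o} → (Pred X ℓ → Set o) → Pred X a → Pred X (a ⊔ suc ℓ ⊔ o)
  closure IsOpen A q = ∀ (U : Pred X ℓ) → IsOpen U → U q → ∃[ r ] (A r × U r)


singleton : ∀ {a} {X : Set a} → X → Pred X a
singleton p r = r ≡ p

module _ {c ℓ₁ ℓ₂ : Level} (L : Lattice c ℓ₁ ℓ₂) where
  open Lattice L

  ℓS : Level
  ℓS = c ⊔ ℓ₁ ⊔ ℓ₂

  Subset : Set (suc ℓS)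
  Subset = Pred Carrier ℓS

  record IsIdeal (I : Subset) : Set ℓS where
    field
      nonempty   : ∃[ x ] I x
      down       : ∀ {x y} → x ≤ y → I y → I x
      join-closed : ∀ {x y} → I x → I y → I (x ∨ y)

  record IsFilter (F : Subset) : Set ℓS where
    field
      nonempty   : ∃[ x ] F x
      up         : ∀ {x y} → x ≤ y → F x → F y
      meet-closed : ∀ {x y} → F x → F y → F (x ∧ y)

  Meets : Subset → Subset → Set ℓS
  Meets A B = ∃[ x ] (A x × B x)

  _⊋_ : Subset → Subset → Set ℓS
  B ⊋ A = A ⊆ B × ¬ (B ⊆ A)

  record IsComaximalPair (I F : Subset) : Set (suc ℓS) where
    field
      ideal     : IsIdeal I
      filter    : IsFilter F
      disjoint  : ¬ Meets I F
      maxIdeal  : ∀ (J : Subset) → IsIdeal J → J ⊋ I → Meets J F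
      maxFilter : ∀ (K : Subset) → IsFilter K → K ⊋ F → Meets K I

  record 𝔐 : Set (suc ℓS) where
    constructor mkPt
    field
      I   : Subset
      F   : Subset
      isCP : IsComaximalPair I F

  σ-basic : Carrier → Pred 𝔐 ℓS
  σ-basic x p = 𝔐.F p x

  τ-subbasic : Carrier → Pred 𝔐 ℓS
  τ-subbasic x p = ¬ 𝔐.I p x

  IsOpenσ : Pred 𝔐 ℓS → Set (suc ℓS)
  IsOpenσ = IsOpenFromBasis σ-basic

  IsOpenτ : Pred 𝔐 ℓS → Set (suc ℓS)
  IsOpenτ = IsOpenFromSubbasis τ-subbasic

  closureσ : Pred 𝔐 (suc ℓS) → Pred 𝔐 (suc ℓS)
  closureσ = closure IsOpenσ

  closureτ : Pred 𝔐 (suc ℓS) → Pred 𝔐 (suc ℓS)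
  closureτ = closure IsOpenτ

  IsPrimePoint : 𝔐 → Set (suc ℓS)
  IsPrimePoint p = ∀ q → (closureτ (singleton p) q → closureσ (singleton p) q)
                        × (closureσ (singleton p) q → closureτ (singleton p) q)

  IsDistributive : Set (c ⊔ ℓ₁ ⊔ ℓ₂)
  IsDistributive = IsDistributiveLattice _≈_ _≤_ _∨_ _∧_

ZornsLemma : (a r : Level) → Set (suc (a ⊔ r))
ZornsLemma a r =
  (A : Set a) (_≼_ : A → A → Set r) →
  (∀ {x} → x ≼ x) → (∀ {x y z} → x ≼ y → y ≼ z → x ≼ z) →
  (∀ (C : Pred A a) → (∀ {x y} → C x → C y → x ≼ y ⊎ y ≼ x) →
     ∃[ u ] (∀ {x} → C x → x ≼ u)) →
  ∃[ m ] (∀ {x} → m ≼ x → x ≼ m)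

LEM : Setω
LEM = ∀ {ℓ} → ExcludedMiddle ℓ

Zorn : Setω
Zorn = ∀ {a r} → ZornsLemma a r

{-# OPTIONS --safe #-}
-- The σ-closure of {p} consists of the pairs q with F q ⊆ F p, its τ-closure
-- of those with I p ⊆ I q.  If every comaximal pair (I , F) partitions L the
-- two conditions coincide, and in a distributive lattice maximality forces
-- each pair to be a partition: for x ∉ I ∪ F one finds i ∈ I, f ∈ F with
-- i ∨ x ∈ F and f ∧ x ∈ I, so f ∧ (i ∨ x) ≤ i ∨ (f ∧ x) lies in both.
-- Conversely, if all points are prime, extending (I , ↑x) by Zorn's lemma
-- shows x ∈ F whenever x ∉ I, so every filter F is prime; separating
-- a ∧ (b ∨ c) from (a ∧ b) ∨ (a ∧ c) by a comaximal pair then puts b or c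
-- in F, hence a ∧ b or a ∧ c in F ∩ I.
module Submission where

open import Defs
open import Level using (Level; Lift; lift; lower)
open import Function.Base using (_∘_; id)
open import Function.Bundles using (_⇔_; mk⇔; Equivalence)
open import Relation.Binary.Lattice using (Lattice; IsDistributiveLattice)
open import Data.Product using (∃-syntax; _×_; _,_; proj₁; proj₂)
open import Data.Sum using (_⊎_; inj₁; inj₂)
open import Data.Bool using (Bool; true; false)
open import Data.Empty using (⊥; ⊥-elim)
open import Data.List using ([]; _∷_)
open import Data.List.Relation.Unary.All as All using ([]; _∷_)
open import Relation.Nullary using (¬_; yes; no)
open import Relation.Nullary.Decidable using (decidable-stable)
open import Relation.Unary using (Pred; _⊆_; _≐_; ∁)
open import Relation.Binary.PropositionalEquality using (_≡_; refl)

open Equivalence using (to; from)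

module _ {c ℓ₁ ℓ₂ : Level} (L : Lattice c ℓ₁ ℓ₂) where
  open Lattice L renaming (refl to ≤-refl; trans to ≤-trans; reflexive to ≤-reflexive)
  open import Relation.Binary.Lattice.Properties.JoinSemilattice joinSemilattice using (∨-monotonic)
  open import Relation.Binary.Lattice.Properties.MeetSemilattice meetSemilattice using (∧-monotonic)

  closureσ-singleton⇔ : ∀ p q → closureσ L (singleton p) q ⇔ (𝔐.F q ⊆ 𝔐.F p)
  closureσ-singleton⇔ p q = mk⇔ closure⇒⊆ ⊆⇒closure
    where
    closure⇒⊆ : closureσ L (singleton p) q → 𝔐.F q ⊆ 𝔐.F p
    closure⇒⊆ cl {x} x∈Fq with cl (σ-basic L x) (λ _ x∈F → x , x∈F , id) x∈Fq
    ... | _ , refl , x∈Fp = x∈Fp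

    ⊆⇒closure : 𝔐.F q ⊆ 𝔐.F p → closureσ L (singleton p) q
    ⊆⇒closure Fq⊆Fp U U-open q∈U with U-open q q∈U
    ... | _ , q∈B , B⊆U = p , refl , B⊆U (Fq⊆Fp q∈B)

  closureτ-singleton⇔ : ∀ p q → closureτ L (singleton p) q ⇔ (∁ (𝔐.I q) ⊆ ∁ (𝔐.I p))
  closureτ-singleton⇔ p q = mk⇔ closure⇒⊆ ⊆⇒closure
    where
    closure⇒⊆ : closureτ L (singleton p) q → ∁ (𝔐.I q) ⊆ ∁ (𝔐.I p)
    closure⇒⊆ cl {x} x∉Iq with cl (τ-subbasic L x) subbasic-open x∉Iq
      where
      subbasic-open : IsOpenτ L (τ-subbasic L x)
      subbasic-open _ x∉I = x ∷ [] , x∉I ∷ [] , λ { _ (x∉I′ ∷ []) → x∉I′ }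
    ... | _ , refl , x∉Ip = x∉Ip

    ⊆⇒closure : ∁ (𝔐.I q) ⊆ ∁ (𝔐.I p) → closureτ L (singleton p) q
    ⊆⇒closure ∁Iq⊆∁Ip U U-open q∈U with U-open q q∈U
    ... | _ , q∈⋂S , ⋂S⊆U = p , refl , ⋂S⊆U p (All.map ∁Iq⊆∁Ip q∈⋂S)

  F⊆∁I : ∀ (p : 𝔐 L) → 𝔐.F p ⊆ ∁ (𝔐.I p)
  F⊆∁I p x∈F x∈I = IsComaximalPair.disjoint (𝔐.isCP p) (_ , x∈I , x∈F)

  ↓_ : Carrier → Subset L
  (↓ b) y = Lift (ℓS L) (y ≤ b)

  ↑_ : Carrier → Subset L
  (↑ a) y = Lift (ℓS L) (a ≤ y)

  ↓-ideal : ∀ b → IsIdeal L (↓ b)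
  ↓-ideal b = record
    { nonempty    = b , lift ≤-refl
    ; down        = λ x≤y y≤b → lift (≤-trans x≤y (lower y≤b))
    ; join-closed = λ x≤b y≤b → lift (∨-least (lower x≤b) (lower y≤b))
    }

  ↑-filter : ∀ a → IsFilter L (↑ a)
  ↑-filter a = record
    { nonempty    = a , lift ≤-refl
    ; up          = λ x≤y a≤x → lift (≤-trans (lower a≤x) x≤y)
    ; meet-closed = λ a≤x a≤y → lift (∧-greatest (lower a≤x) (lower a≤y))
    }

  adjoinIdeal : Subset L → Carrier → Subset L
  adjoinIdeal I x y = ∃[ i ] (I i × y ≤ i ∨ x)

  adjoinFilter : Subset L → Carrier → Subset L
  adjoinFilter F x y = ∃[ f ] (F f × f ∧ x ≤ y)

  x∈adjoinIdeal : ∀ {I} x → IsIdeal L I → adjoinIdeal I x x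
  x∈adjoinIdeal x I-ideal = let i , i∈I = IsIdeal.nonempty I-ideal in i , i∈I , y≤x∨y i x

  x∈adjoinFilter : ∀ {F} x → IsFilter L F → adjoinFilter F x x
  x∈adjoinFilter x F-filter = let f , f∈F = IsFilter.nonempty F-filter in f , f∈F , x∧y≤y f x

  adjoinIdeal-⊋ : ∀ {I x} → IsIdeal L I → ¬ I x → _⊋_ L (adjoinIdeal I x) I
  adjoinIdeal-⊋ {x = x} I-ideal x∉I =
    (λ {y} y∈I → y , y∈I , x≤x∨y y x) , λ J⊆I → x∉I (J⊆I (x∈adjoinIdeal x I-ideal))

  adjoinFilter-⊋ : ∀ {F x} → IsFilter L F → ¬ F x → _⊋_ L (adjoinFilter F x) F
  adjoinFilter-⊋ {x = x} F-filter x∉F =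
    (λ {y} y∈F → y , y∈F , x∧y≤x y x) , λ K⊆F → x∉F (K⊆F (x∈adjoinFilter x F-filter))

  adjoinIdeal-ideal : ∀ {I} x → IsIdeal L I → IsIdeal L (adjoinIdeal I x)
  adjoinIdeal-ideal x I-ideal = record
    { nonempty    = x , x∈adjoinIdeal x I-ideal
    ; down        = λ { y≤z (i , i∈I , z≤i∨x) → i , i∈I , ≤-trans y≤z z≤i∨x }
    ; join-closed = λ { (i , i∈I , y≤i∨x) (j , j∈I , z≤j∨x) →
        i ∨ j , IsIdeal.join-closed I-ideal i∈I j∈I
              , ∨-least (≤-trans y≤i∨x (∨-monotonic (x≤x∨y i j) ≤-refl))
                        (≤-trans z≤j∨x (∨-monotonic (y≤x∨y i j) ≤-refl)) }
    }

  adjoinFilter-filter : ∀ {F} x → IsFilter L F → IsFilter L (adjoinFilter F x)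
  adjoinFilter-filter x F-filter = record
    { nonempty    = x , x∈adjoinFilter x F-filter
    ; up          = λ { y≤z (f , f∈F , f∧x≤y) → f , f∈F , ≤-trans f∧x≤y y≤z }
    ; meet-closed = λ { (f , f∈F , f∧x≤y) (g , g∈F , g∧x≤z) →
        f ∧ g , IsFilter.meet-closed F-filter f∈F g∈F
              , ∧-greatest (≤-trans (∧-monotonic (x∧y≤x f g) ≤-refl) f∧x≤y)
                           (≤-trans (∧-monotonic (x∧y≤y f g) ≤-refl) g∧x≤z) }
    }

  ∉I⇒∨∈F : ∀ (p : 𝔐 L) {x} → ¬ 𝔐.I p x → ∃[ i ] (𝔐.I p i × 𝔐.F p (i ∨ x))
  ∉I⇒∨∈F (mkPt I F cp) {x} x∉I =
    let y , (i , i∈I , y≤i∨x) , y∈F =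
          maxIdeal (adjoinIdeal I x) (adjoinIdeal-ideal x ideal) (adjoinIdeal-⊋ ideal x∉I)
    in i , i∈I , IsFilter.up filter y≤i∨x y∈F
    where open IsComaximalPair cp

  ∉F⇒∧∈I : ∀ (p : 𝔐 L) {x} → ¬ 𝔐.F p x → ∃[ f ] (𝔐.F p f × 𝔐.I p (f ∧ x))
  ∉F⇒∧∈I (mkPt I F cp) {x} x∉F =
    let y , (f , f∈F , f∧x≤y) , y∈I =
          maxFilter (adjoinFilter F x) (adjoinFilter-filter x filter) (adjoinFilter-⊋ filter x∉F)
    in f , f∈F , IsIdeal.down ideal f∧x≤y y∈I
    where open IsComaximalPair cp

  IsIdeal-resp-≐ : ∀ {P Q} → P ≐ Q → IsIdeal L P → IsIdeal L Q
  IsIdeal-resp-≐ (P⊆Q , Q⊆P) P-ideal = record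
    { nonempty    = let x , x∈P = IsIdeal.nonempty P-ideal in x , P⊆Q x∈P
    ; down        = λ x≤y y∈Q → P⊆Q (IsIdeal.down P-ideal x≤y (Q⊆P y∈Q))
    ; join-closed = λ x∈Q y∈Q → P⊆Q (IsIdeal.join-closed P-ideal (Q⊆P x∈Q) (Q⊆P y∈Q))
    }

  IsFilter-resp-≐ : ∀ {P Q} → P ≐ Q → IsFilter L P → IsFilter L Q
  IsFilter-resp-≐ (P⊆Q , Q⊆P) P-filter = record
    { nonempty    = let x , x∈P = IsFilter.nonempty P-filter in x , P⊆Q x∈P
    ; up          = λ x≤y x∈Q → P⊆Q (IsFilter.up P-filter x≤y (Q⊆P x∈Q))
    ; meet-closed = λ x∈Q y∈Q → P⊆Q (IsFilter.meet-closed P-filter (Q⊆P x∈Q) (Q⊆P y∈Q))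
    }

  IsComplementaryPair : 𝔐 L → Set (ℓS L)
  IsComplementaryPair p = ∁ (𝔐.I p) ⊆ 𝔐.F p

  complementary⇒prime : (∀ p → IsComplementaryPair p) → ∀ p → IsPrimePoint L p
  complementary⇒prime complementary p q =
      (λ clτ → from (closureσ-singleton⇔ p q)
                 (λ x∈Fq → complementary p (to (closureτ-singleton⇔ p q) clτ (F⊆∁I q x∈Fq))))
    , (λ clσ → from (closureτ-singleton⇔ p q)
                 (λ x∉Iq → F⊆∁I p (to (closureσ-singleton⇔ p q) clσ (complementary q x∉Iq))))

  module _ (lem : LEM) where

    stable : ∀ {a} {A : Set a} → ¬ ¬ A → A
    stable = decidable-stable lem

    distributive⇒complementary : IsDistributive L → ∀ p → IsComplementaryPair p
    distributive⇒complementary distributive p {x} x∉I = stable λ x∉F →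
      let i , i∈I , i∨x∈F = ∉I⇒∨∈F p x∉I
          f , f∈F , f∧x∈I = ∉F⇒∧∈I p x∉F
      in F⊆∁I p (IsFilter.meet-closed filter f∈F i∨x∈F)
                (IsIdeal.down ideal (f∧[i∨x]≤i∨[f∧x] f i) (IsIdeal.join-closed ideal i∈I f∧x∈I))
      where
      open IsComaximalPair (𝔐.isCP p)
      f∧[i∨x]≤i∨[f∧x] : ∀ f i → f ∧ (i ∨ x) ≤ i ∨ (f ∧ x)
      f∧[i∨x]≤i∨[f∧x] f i = ≤-trans (≤-reflexive (IsDistributiveLattice.∧-distribˡ-∨ distributive f i x))
                                    (∨-monotonic (x∧y≤y f i) ≤-refl)

    complementary⇒F-prime : ∀ p → IsComplementaryPair p → ∀ {b c} →
                            𝔐.F p (b ∨ c) → ¬ 𝔐.F p b → ¬ 𝔐.F p c → ⊥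
    complementary⇒F-prime p complementary b∨c∈F b∉F c∉F =
      F⊆∁I p b∨c∈F (IsIdeal.join-closed (IsComaximalPair.ideal (𝔐.isCP p)) (∉F⇒∈I b∉F) (∉F⇒∈I c∉F))
      where
      ∉F⇒∈I : ∀ {x} → ¬ 𝔐.F p x → 𝔐.I p x
      ∉F⇒∈I x∉F = stable (x∉F ∘ complementary)

    -- A record with Subset fields would live one universe above Subset L, where
    -- the union of a chain is no longer a Subset; candidate pairs therefore
    -- store Bool-valued characteristic functions, which exist by excluded middle.
    ⟦_⟧ : (Carrier → Bool) → Subset L
    ⟦ χ ⟧ x = Lift (ℓS L) (χ x ≡ true)

    characteristic : Subset L → Carrier → Bool
    characteristic P x with lem {P = P x}
    ... | yes _ = true
    ... | no  _ = false

    characteristic-≐ : ∀ P → P ≐ ⟦ characteristic P ⟧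
    characteristic-≐ P = complete , sound
      where
      complete : P ⊆ ⟦ characteristic P ⟧
      complete {x} x∈P with lem {P = P x}
      ... | yes _   = lift refl
      ... | no  x∉P = ⊥-elim (x∉P x∈P)

      sound : ⟦ characteristic P ⟧ ⊆ P
      sound {x} χx with lem {P = P x}
      sound χx       | yes x∈P = x∈P
      sound (lift ()) | no  _

    module Extension (zorn : Zorn) {I₀ F₀ : Subset L} (I₀-ideal : IsIdeal L I₀) (F₀-filter : IsFilter L F₀)
                     (I₀∩F₀=∅ : ¬ Meets L I₀ F₀) where

      record Candidate : Set (ℓS L) where
        field
          I F      : Carrier → Bool
          ideal    : IsIdeal L ⟦ I ⟧
          filter   : IsFilter L ⟦ F ⟧
          disjoint : ¬ Meets L ⟦ I ⟧ ⟦ F ⟧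
          I₀⊆I     : I₀ ⊆ ⟦ I ⟧
          F₀⊆F     : F₀ ⊆ ⟦ F ⟧
      open Candidate

      _≼_ : Candidate → Candidate → Set (ℓS L)
      p ≼ q = ⟦ I p ⟧ ⊆ ⟦ I q ⟧ × ⟦ F p ⟧ ⊆ ⟦ F q ⟧

      ≼-refl : ∀ {p} → p ≼ p
      ≼-refl = id , id

      ≼-trans : ∀ {p q r} → p ≼ q → q ≼ r → p ≼ r
      ≼-trans (Ip⊆Iq , Fp⊆Fq) (Iq⊆Ir , Fq⊆Fr) = Iq⊆Ir ∘ Ip⊆Iq , Fq⊆Fr ∘ Fp⊆Fq

      IsChain : Pred Candidate (ℓS L) → Set (ℓS L)
      IsChain C = ∀ {p q} → C p → C q → p ≼ q ⊎ q ≼ p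

      initial : Candidate
      initial = record
        { I        = characteristic I₀
        ; F        = characteristic F₀
        ; ideal    = IsIdeal-resp-≐ (characteristic-≐ I₀) I₀-ideal
        ; filter   = IsFilter-resp-≐ (characteristic-≐ F₀) F₀-filter
        ; disjoint = λ { (x , x∈I , x∈F) →
            I₀∩F₀=∅ (x , proj₂ (characteristic-≐ I₀) x∈I , proj₂ (characteristic-≐ F₀) x∈F) }
        ; I₀⊆I     = proj₁ (characteristic-≐ I₀)
        ; F₀⊆F     = proj₁ (characteristic-≐ F₀)
        }

      initial-≼ : ∀ p → initial ≼ p
      initial-≼ p = I₀⊆I p ∘ proj₂ (characteristic-≐ I₀) , F₀⊆F p ∘ proj₂ (characteristic-≐ F₀)

      module ChainUnion {C : Pred Candidate (ℓS L)} (C-chain : IsChain C) {p₀} (p₀∈C : C p₀) where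

        ⋃I : Subset L
        ⋃I x = ∃[ p ] (C p × ⟦ I p ⟧ x)

        ⋃F : Subset L
        ⋃F x = ∃[ p ] (C p × ⟦ F p ⟧ x)

        upper-bound₂ : ∀ {p q} → C p → C q → ∃[ r ] (C r × p ≼ r × q ≼ r)
        upper-bound₂ {p} {q} p∈C q∈C with C-chain p∈C q∈C
        ... | inj₁ p≼q = q , q∈C , p≼q , ≼-refl {q}
        ... | inj₂ q≼p = p , p∈C , ≼-refl {p} , q≼p

        ⋃I-ideal : IsIdeal L ⋃I
        ⋃I-ideal = record
          { nonempty    = let x , x∈I = IsIdeal.nonempty (ideal p₀) in x , p₀ , p₀∈C , x∈I
          ; down        = λ { x≤y (p , p∈C , y∈I) → p , p∈C , IsIdeal.down (ideal p) x≤y y∈I }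
          ; join-closed = λ { (p , p∈C , x∈I) (q , q∈C , y∈I) →
              let r , r∈C , (Ip⊆Ir , _) , (Iq⊆Ir , _) = upper-bound₂ p∈C q∈C
              in r , r∈C , IsIdeal.join-closed (ideal r) (Ip⊆Ir x∈I) (Iq⊆Ir y∈I) }
          }

        ⋃F-filter : IsFilter L ⋃F
        ⋃F-filter = record
          { nonempty    = let x , x∈F = IsFilter.nonempty (filter p₀) in x , p₀ , p₀∈C , x∈F
          ; up          = λ { x≤y (p , p∈C , x∈F) → p , p∈C , IsFilter.up (filter p) x≤y x∈F }
          ; meet-closed = λ { (p , p∈C , x∈F) (q , q∈C , y∈F) →
              let r , r∈C , (_ , Fp⊆Fr) , (_ , Fq⊆Fr) = upper-bound₂ p∈C q∈C
              in r , r∈C , IsFilter.meet-closed (filter r) (Fp⊆Fr x∈F) (Fq⊆Fr y∈F) }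
          }

        ⋃-disjoint : ¬ Meets L ⋃I ⋃F
        ⋃-disjoint (x , (p , p∈C , x∈Ip) , (q , q∈C , x∈Fq)) =
          let r , _ , (Ip⊆Ir , _) , (_ , Fq⊆Fr) = upper-bound₂ p∈C q∈C
          in disjoint r (x , Ip⊆Ir x∈Ip , Fq⊆Fr x∈Fq)

        ⋃ : Candidate
        ⋃ = record
          { I        = characteristic ⋃I
          ; F        = characteristic ⋃F
          ; ideal    = IsIdeal-resp-≐ (characteristic-≐ ⋃I) ⋃I-ideal
          ; filter   = IsFilter-resp-≐ (characteristic-≐ ⋃F) ⋃F-filter
          ; disjoint = λ { (x , x∈I , x∈F) →
              ⋃-disjoint (x , proj₂ (characteristic-≐ ⋃I) x∈I , proj₂ (characteristic-≐ ⋃F) x∈F) }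
          ; I₀⊆I     = λ x∈I₀ → proj₁ (characteristic-≐ ⋃I) (p₀ , p₀∈C , I₀⊆I p₀ x∈I₀)
          ; F₀⊆F     = λ x∈F₀ → proj₁ (characteristic-≐ ⋃F) (p₀ , p₀∈C , F₀⊆F p₀ x∈F₀)
          }

        ⋃-upper : ∀ {p} → C p → p ≼ ⋃
        ⋃-upper {p} p∈C = (λ x∈I → proj₁ (characteristic-≐ ⋃I) (p , p∈C , x∈I))
                        , (λ x∈F → proj₁ (characteristic-≐ ⋃F) (p , p∈C , x∈F))

      chain-bounded : ∀ C → IsChain C → ∃[ u ] (∀ {p} → C p → p ≼ u)
      chain-bounded C C-chain = ⋃ , ⋃-upper ∘ inj₂
        where
        -- Adjoining the initial candidate keeps the union nonempty when C is empty.
        C⁺ : Pred Candidate (ℓS L)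
        C⁺ p = initial ≡ p ⊎ C p

        C⁺-chain : IsChain C⁺
        C⁺-chain {q = q} (inj₁ refl) _           = inj₁ (initial-≼ q)
        C⁺-chain {p}     (inj₂ _)    (inj₁ refl) = inj₂ (initial-≼ p)
        C⁺-chain         (inj₂ p∈C)  (inj₂ q∈C)  = C-chain p∈C q∈C

        open ChainUnion {C⁺} C⁺-chain (inj₁ refl)

      maximal : ∃[ m ] (∀ {p} → m ≼ p → p ≼ m)
      maximal = zorn Candidate _≼_ (λ {p} → ≼-refl {p}) (λ {p} {q} {r} → ≼-trans {p} {q} {r}) chain-bounded

      m : Candidate
      m = proj₁ maximal

      m-comaximal : IsComaximalPair L ⟦ I m ⟧ ⟦ F m ⟧
      m-comaximal = record
        { ideal     = ideal m
        ; filter    = filter m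
        ; disjoint  = disjoint m
        ; maxIdeal  = maxIdeal
        ; maxFilter = maxFilter
        }
        where
        maxIdeal : ∀ J → IsIdeal L J → _⊋_ L J ⟦ I m ⟧ → Meets L J ⟦ F m ⟧
        maxIdeal J J-ideal (Im⊆J , J⊈Im) = stable λ J∩Fm=∅ →
          let J⊆χJ , χJ⊆J = characteristic-≐ J
              m′ = record m
                { I        = characteristic J
                ; ideal    = IsIdeal-resp-≐ (characteristic-≐ J) J-ideal
                ; disjoint = λ { (x , x∈J , x∈F) → J∩Fm=∅ (x , χJ⊆J x∈J , x∈F) }
                ; I₀⊆I     = J⊆χJ ∘ Im⊆J ∘ I₀⊆I m
                }
          in J⊈Im (proj₁ (proj₂ maximal {m′} (J⊆χJ ∘ Im⊆J , id)) ∘ J⊆χJ)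

        maxFilter : ∀ K → IsFilter L K → _⊋_ L K ⟦ F m ⟧ → Meets L K ⟦ I m ⟧
        maxFilter K K-filter (Fm⊆K , K⊈Fm) = stable λ K∩Im=∅ →
          let K⊆χK , χK⊆K = characteristic-≐ K
              m′ = record m
                { F        = characteristic K
                ; filter   = IsFilter-resp-≐ (characteristic-≐ K) K-filter
                ; disjoint = λ { (x , x∈I , x∈K) → K∩Im=∅ (x , χK⊆K x∈K , x∈I) }
                ; F₀⊆F     = K⊆χK ∘ Fm⊆K ∘ F₀⊆F m
                }
          in K⊈Fm (proj₂ (proj₂ maximal {m′} (id , K⊆χK ∘ Fm⊆K)) ∘ K⊆χK)

      extension : ∃[ p ] (I₀ ⊆ 𝔐.I p × F₀ ⊆ 𝔐.F p)
      extension = mkPt ⟦ I m ⟧ ⟦ F m ⟧ m-comaximal , I₀⊆I m , F₀⊆F m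

    module _ (zorn : Zorn) where

      extend : ∀ {I₀ F₀} → IsIdeal L I₀ → IsFilter L F₀ → ¬ Meets L I₀ F₀ →
               ∃[ p ] (I₀ ⊆ 𝔐.I p × F₀ ⊆ 𝔐.F p)
      extend = Extension.extension zorn

      separation : ∀ {a b} → ¬ a ≤ b → ∃[ p ] (𝔐.I p b × 𝔐.F p a)
      separation {a} {b} a≰b =
        let p , ↓b⊆I , ↑a⊆F = extend (↓-ideal b) (↑-filter a)
                                 λ { (x , lift x≤b , lift a≤x) → a≰b (≤-trans a≤x x≤b) }
        in p , ↓b⊆I (lift ≤-refl) , ↑a⊆F (lift ≤-refl)

      prime⇒complementary : (∀ p → IsPrimePoint L p) → ∀ p → IsComplementaryPair p
      prime⇒complementary prime p {x} x∉I =
        let q , Ip⊆Iq , ↑x⊆Fq = extend I-ideal (↑-filter x)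
                                   λ { (y , y∈I , lift x≤y) → x∉I (IsIdeal.down I-ideal x≤y y∈I) }
            q∈clτ = from (closureτ-singleton⇔ p q) (λ y∉Iq → y∉Iq ∘ Ip⊆Iq)
        in to (closureσ-singleton⇔ p q) (proj₁ (prime p q) q∈clτ) (↑x⊆Fq (lift ≤-refl))
        where
        I-ideal : IsIdeal L (𝔐.I p)
        I-ideal = IsComaximalPair.ideal (𝔐.isCP p)

      complementary⇒distributive : (∀ p → IsComplementaryPair p) → IsDistributive L
      complementary⇒distributive complementary = record
        { isLattice    = isLattice
        ; ∧-distribˡ-∨ = λ a b c → antisym (∧-distribˡ-∨-≤ a b c)
            (∨-least (∧-monotonic ≤-refl (x≤x∨y b c)) (∧-monotonic ≤-refl (y≤x∨y b c)))
        }
        where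
        ∧-distribˡ-∨-≤ : ∀ a b c → a ∧ (b ∨ c) ≤ (a ∧ b) ∨ (a ∧ c)
        ∧-distribˡ-∨-≤ a b c = stable λ lhs≰rhs →
          let p , rhs∈I , lhs∈F = separation lhs≰rhs
              open IsComaximalPair (𝔐.isCP p)
              a∈F   = IsFilter.up filter (x∧y≤x a (b ∨ c)) lhs∈F
              b∨c∈F = IsFilter.up filter (x∧y≤y a (b ∨ c)) lhs∈F
              a∧x≤rhs⇒x∉F : ∀ {x} → a ∧ x ≤ (a ∧ b) ∨ (a ∧ c) → ¬ 𝔐.F p x
              a∧x≤rhs⇒x∉F a∧x≤rhs x∈F =
                F⊆∁I p (IsFilter.meet-closed filter a∈F x∈F) (IsIdeal.down ideal a∧x≤rhs rhs∈I)
          in complementary⇒F-prime p (complementary p) b∨c∈F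
               (a∧x≤rhs⇒x∉F (x≤x∨y _ _)) (a∧x≤rhs⇒x∉F (y≤x∨y _ _))

mainTheorem8 : LEM → Zorn → {c ℓ₁ ℓ₂ : Level} (L : Lattice c ℓ₁ ℓ₂) →
    IsDistributive L ⇔ (∀ (p : 𝔐 L) → IsPrimePoint L p)
mainTheorem8 lem zorn L = mk⇔
  (complementary⇒prime L ∘ distributive⇒complementary L lem)
  (complementary⇒distributive L lem zorn ∘ prime⇒complementary L lem zorn)
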